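{- Let $r \in \mathbb{N}$ and let $\mathcal{P}$ be a hereditary property of graphs with $\chi_c(\mathcal{P}) = r$. Let $\alpha > 0$, and let $\varepsilon, \delta, \gamma > 0$ be sufficiently small. Then $\mathcal{D}(\mathcal{P}_n,\alpha) \subset \mathcal{C}(\mathcal{P}_n,\alpha)$.
   Context: A hereditary property $\mathcal{P}$ is a class of labelled graphs closed under relabelling and induced subgraphs; $\mathcal{P}_n$ is its set of graphs on $[n]$; $\chi_c(\mathcal{P}) = \max\{r : \mathcal{H}(r,v) \subset \mathcal{P} \text{ for some } v \in\{0,1\}^r\}$, where $\mathcal{H}(r,v)$ is the class of graphs whose vertex set partitions into $A_1,\ldots,A_r$ with $G[A_j]$ empty if $v_j=0$ and complete if $v_j=1$. For disjoint vertex sets, $d(X,Y) = e(X,Y)/(|X||Y|)$; $(A,B)$ is $\varepsilon$-regular if $|d(A,B)-d(X,Y)|<\varepsilon$ for all $X\subset A$, $Y \subset B$ with $|X|\geqslant \varepsilon|A|$, $|Y|\geqslant\varepsilon|B|$, and $(\varepsilon,\delta)$-grey if moreover $\delta \leqslant d(A,B) \leqslant 1-\delta$. A Szemerédi partition for $\varepsilon$ is a partition $V(G) = A_1 \cup \cdots \cup A_m$ with $|A_1| \leqslant \cdots \leqslant |A_m| \leqslant |A_1|+1$ and all but at most $\varepsilon m^2$ pairs $\varepsilon$-regular. $P=(S_1,\ldots,S_r)$ is a BBS-partition for $(\varepsilon,\delta,\gamma)$ if there is a Szemerédi partition for $\varepsilon$ into $m > 1/\varepsilon$ parts such that each $S_j$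 is a union of an almost equal number of Szemerédi parts (so $(1/r-\varepsilon)n \leqslant |S_j| \leqslant (1/r+\varepsilon)n$) and each $S_j$ contains at most $\gamma m^2$ $(\varepsilon,\delta)$-grey pairs of parts. For $G$ on $n$ vertices and partition $P$, $B \subset V(G)$ is $\beta$-bad for $(G,P)$ if $|(\Gamma(u)\cap S_j) \triangle (\Gamma(v) \cap S_j)| \geqslant \beta n$ for all distinct $u,v\in B$ and all $j$; maximal means inclusion-maximal among $\beta$-bad sets. $u$ is a $\beta$-clone of $v$ w.r.t. $A$ if $|(\Gamma(u)\cap A) \triangle (\Gamma(v) \cap A)| \leqslant \beta n$. For a maximal $\beta$-bad $B$, $j(v) := \min\{j : \exists b \in B,\ v \text{ is a } \beta\text{ -clone of } b \text{ w.r.t. } S_j\}$ and $J(G,P,B,\beta) := \{v : v \notin S_{j(v)}\}$. $\mathcal{C}(\mathcal{P}_n,\alpha)$ is the set of $G \in \mathcal{P}_n$ having a BBS-partition $P$ for $(\varepsilon,\delta,\gamma)$ and a maximal $(2\alpha)$-bad set $B$ for $(G,P)$ with $|J(G,P,B,2\alpha)| \geqslant \alpha n$. Given a BBS-partition $P = (S_1,\ldots,S_r)$ and a maximal $(2\alpha)$-bad set $B$ for $(G,P)$, an $\alpha$-adjustment of $(G,P)$ with respect to $B$ is a partition $P' = (S'_1,\ldots,S'_r)$ of $V(G)$ such that for each $j$, $|S_j \triangle S'_j| \leqslant \alpha n$ and every $v \in S'_j$ is a $(3\alpha)$-clone, with respect to $S'_j$, of some $b \in B$. $\mathcal{D}(\mathcal{P}_n,\alpha)$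 is the set of $G \in \mathcal{P}_n$ for which there exist a BBS-partition $P$ for $(\varepsilon,\delta,\gamma)$ and a maximal $(2\alpha)$-bad set $B$ for $(G,P)$ such that no $\alpha$-adjustment of $(G,P)$ with respect to $B$ exists.
   Formalization: The parameters α, ε, δ and γ are taken in the positive rationals. -}

module Defs where

open import Data.Bool using (Bool; true; false; if_then_else_; _∧_; not; _xor_)
open import Data.Nat as ℕ using (ℕ; zero; suc)
open import Data.Fin as Fin using (Fin)
open import Data.Integer using (+_)
open import Data.Rational using (ℚ; _/_; 0ℚ; 1ℚ; _*_; _-_; ∣_∣; _≤_; _<_)
open import Data.Product using (Σ; ∃; _×_; _,_)
open import Data.Vec using (Vec; lookup)
open import Relation.Binary.PropositionalEquality using (_≡_; _≢_)
open import Relation.Nullary using (¬_; Dec; yes; no)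
open import Function.Definitions using (Injective)

#ℚ : ℕ → ℚ
#ℚ n = (+ n) / 1

VSet : ℕ → Set
VSet n = Fin n → Bool

size : ∀ {n} → (Fin n → Bool) → ℕ
size {zero}  X = zero
size {suc n} X = (if X Fin.zero then 1 else 0) ℕ.+ size (λ i → X (Fin.suc i))

_∈ₛ_ : ∀ {n} → Fin n → VSet n → Set
x ∈ₛ X = X x ≡ true

_⊆ₛ_ : ∀ {n} → VSet n → VSet n → Set
X ⊆ₛ Y = ∀ x → x ∈ₛ X → x ∈ₛ Y

-- a set of (unordered) pairs of indices, given as a relation; we only
-- look at pairs i < j
PairSet : ℕ → Set
PairSet m = Fin m → Fin m → Bool

isLt : ∀ {m} → Fin m → Fin m → Bool
isLt i j with i Fin.<? j
... | yes _ = true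
... | no  _ = false

sumFin : ∀ {k} → (Fin k → ℕ) → ℕ
sumFin {zero}  g = zero
sumFin {suc k} g = g Fin.zero ℕ.+ sumFin (λ i → g (Fin.suc i))

pairCount : ∀ {m} → PairSet m → ℕ
pairCount E = sumFin (λ i → size (λ j → isLt i j ∧ E i j))

-- "at most k (unordered) pairs satisfy Q":
-- the pairs satisfying Q are contained in a pair-set of size at most k
AtMostPairs : ∀ {m} → ℚ → (Fin m → Fin m → Set) → Set
AtMostPairs {m} k Q =
  Σ (PairSet m) λ E → (#ℚ (pairCount E) ≤ k) ×
    (∀ i j → i Fin.< j → Q i j → E i j ≡ true)

AllButPairs : ∀ {m} → ℚ → (Fin m → Fin m → Set) → Set
AllButPairs {m} k Q =
  Σ (PairSet m) λ E → (#ℚ (pairCount E) ≤ k) ×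
    (∀ i j → i Fin.< j → E i j ≡ false → Q i j)

record Graph (n : ℕ) : Set where
  field
    adj    : Fin n → Fin n → Bool
    sym    : ∀ x y → adj x y ≡ adj y x
    irrefl : ∀ x → adj x x ≡ false
open Graph public

pullback : ∀ {m n} → (Fin m → Fin n) → Graph n → Graph m
pullback f G = record
  { adj    = λ x y → adj G (f x) (f y)
  ; sym    = λ x y → sym G (f x) (f y)
  ; irrefl = λ x → irrefl G (f x) }

-- A hereditary property: a class of labelled graphs closed under
-- relabelling and taking induced subgraphs (both = pulling back along
-- an injection Fin m → Fin n).
record Hereditary : Set₁ where
  field
    holds     : (n : ℕ) → Graph n → Set
    inherited : ∀ {m n} (f : Fin m → Fin n) → Injective _≡_ _≡_ f →
                (G : Graph n) → holds n G → holds m (pullback f G)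
open Hereditary public

-- 𝓗(r,v): vertex set partitioned into A_1..A_r (c x = index of the part of x),
-- each G[A_j] empty (v_j = false) or complete (v_j = true)
InH : (r : ℕ) → Vec Bool r → (n : ℕ) → Graph n → Set
InH r v n G = Σ (Fin n → Fin r) λ c →
  ∀ x y → x ≢ y → c x ≡ c y → adj G x y ≡ lookup v (c x)

HSubset : (r : ℕ) → Vec Bool r → Hereditary → Set
HSubset r v 𝓟 = ∀ n (G : Graph n) → InH r v n G → holds 𝓟 n G

-- χ_c(𝓟) = r : r is the maximum of { r' : 𝓗(r',v) ⊆ 𝓟 for some v }
χc≡ : Hereditary → ℕ → Set
χc≡ 𝓟 r = (Σ (Vec Bool r) λ v → HSubset r v 𝓟) ×
          (∀ r' → r ℕ.< r' → ∀ (v : Vec Bool r') → ¬ HSubset r' v 𝓟)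

2ℚ 3ℚ : ℚ
2ℚ = #ℚ 2
3ℚ = #ℚ 3

module _ {n : ℕ} (G : Graph n) where

  eXY : VSet n → VSet n → ℕ
  eXY X Y = sumFin (λ x → size (λ y → X x ∧ (Y y ∧ adj G x y)))

  -- d(X,Y) = e(X,Y)/(|X||Y|)   (convention: 0 if X or Y is empty)
  dens : VSet n → VSet n → ℚ
  dens X Y = ratio (eXY X Y) (size X ℕ.* size Y)
    where
    ratio : ℕ → ℕ → ℚ
    ratio e zero = 0ℚ
    ratio e (suc k) = (+ e) / suc k

  Regular : ℚ → VSet n → VSet n → Set
  Regular ε A B = ∀ X Y → X ⊆ₛ A → Y ⊆ₛ B →
    ε * #ℚ (size A) ≤ #ℚ (size X) → ε * #ℚ (size B) ≤ #ℚ (size Y) →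
    ∣ dens A B - dens X Y ∣ < ε

  Grey : ℚ → ℚ → VSet n → VSet n → Set
  Grey ε δ A B = Regular ε A B × (δ ≤ dens A B) × (dens A B ≤ 1ℚ - δ)

  part : ∀ {m} → (Fin n → Fin m) → Fin m → VSet n
  part p i x = isEq (p x) i
    where
    isEq : ∀ {m} → Fin m → Fin m → Bool
    isEq a b with a Fin.≟ b
    ... | yes _ = true
    ... | no  _ = false

  Szemeredi : ℚ → (m : ℕ) → (Fin n → Fin m) → Set
  Szemeredi ε m p =
    (∀ i j → i Fin.≤ j → size (part p i) ℕ.≤ size (part p j)) ×
    (∀ i j → size (part p j) ℕ.≤ suc (size (part p i))) ×
    AllButPairs (ε * #ℚ (m ℕ.* m)) (λ i j → Regular ε (part p i) (part p j))

  BBS : ℚ → ℚ → ℚ → (r : ℕ) → (Fin n → Fin r) → Set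
  BBS ε δ γ r s = Σ ℕ λ m → Σ (Fin n → Fin m) λ p →
    Szemeredi ε m p × (1ℚ < ε * #ℚ m) ×
    Σ (Fin m → Fin r) λ f →
      (∀ x → s x ≡ f (p x)) ×
      (∀ j k → size (λ i → part' f j i) ℕ.≤ suc (size (λ i → part' f k i))) ×
      (∀ j → AtMostPairs (γ * #ℚ (m ℕ.* m))
               (λ i i' → f i ≡ j × f i' ≡ j × Grey ε δ (part p i) (part p i')))
    where
    part' : ∀ {m r} → (Fin m → Fin r) → Fin r → Fin m → Bool
    part' f j i with f i Fin.≟ j
    ... | yes _ = true
    ... | no  _ = false

  nbDiff : Fin n → Fin n → VSet n → ℕ
  nbDiff u v A = size (λ w → A w ∧ (adj G u w xor adj G v w))

  Clone : ℚ → Fin n → Fin n → VSet n → Set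
  Clone β u v A = #ℚ (nbDiff u v A) ≤ β * #ℚ n

  Bad : ℚ → ∀ {r} → (Fin n → Fin r) → VSet n → Set
  Bad β {r} s B = ∀ u v → u ∈ₛ B → v ∈ₛ B → u ≢ v → ∀ (j : Fin r) →
    β * #ℚ n ≤ #ℚ (nbDiff u v (part s j))

  MaxBad : ℚ → ∀ {r} → (Fin n → Fin r) → VSet n → Set
  MaxBad β s B = Bad β s B × (∀ B' → Bad β s B' → B ⊆ₛ B' → B' ⊆ₛ B)

  HasCloneIn : ℚ → ∀ {r} → (Fin n → Fin r) → VSet n → Fin n → Fin r → Set
  HasCloneIn β s B v j = Σ (Fin n) λ b → b ∈ₛ B × Clone β v b (part s j)

  IsJ : ℚ → ∀ {r} → (Fin n → Fin r) → VSet n → Fin n → Fin r → Set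
  IsJ β s B v j = HasCloneIn β s B v j ×
                  (∀ j' → j' Fin.< j → ¬ HasCloneIn β s B v j')

  InJ : ℚ → ∀ {r} → (Fin n → Fin r) → VSet n → Fin n → Set
  InJ β s B v = Σ _ λ j → IsJ β s B v j × s v ≢ j

  JAtLeast : ℚ → ∀ {r} → (Fin n → Fin r) → VSet n → ℚ → Set
  JAtLeast β s B k = Σ (VSet n) λ T → (k ≤ #ℚ (size T)) ×
                       (∀ v → v ∈ₛ T → InJ β s B v)

  symDiff : VSet n → VSet n → ℕ
  symDiff X Y = size (λ w → X w xor Y w)

  Adjustment : ℚ → ∀ {r} → (Fin n → Fin r) → VSet n → (Fin n → Fin r) → Set
  Adjustment α s B s' =
    (∀ j → #ℚ (symDiff (part s j) (part s' j)) ≤ α * #ℚ n) ×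
    (∀ v → Σ (Fin n) λ b → b ∈ₛ B × Clone (3ℚ * α) v b (part s' (s' v)))

InC : Hereditary → (r : ℕ) → (ε δ γ α : ℚ) → (n : ℕ) → Graph n → Set
InC 𝓟 r ε δ γ α n G = holds 𝓟 n G ×
  Σ (Fin n → Fin r) λ s → BBS G ε δ γ r s ×
  Σ (VSet n) λ B → MaxBad G (2ℚ * α) s B ×
  JAtLeast G (2ℚ * α) s B (α * #ℚ n)

InD : Hereditary → (r : ℕ) → (ε δ γ α : ℚ) → (n : ℕ) → Graph n → Set
InD 𝓟 r ε δ γ α n G = holds 𝓟 n G ×
  Σ (Fin n → Fin r) λ s → BBS G ε δ γ r s ×
  Σ (VSet n) λ B → MaxBad G (2ℚ * α) s B ×
  ¬ (Σ (Fin n → Fin r) λ s' → Adjustment G α s B s')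

module Submission where

-- If a graph G lies in 𝓓(𝓟_n, α) then it lies in 𝓒(𝓟_n, α); the property
-- 𝓟, the value of χ_c and the constants ε, δ, γ play no role.
--
-- Fix G, a partition P = (S_1,…,S_r) given by s : V → Fin r and a maximal
-- (2α)-bad set B.  Maximality of B forces every vertex v to be a
-- (2α)-clone, with respect to some S_j, of some b ∈ B (otherwise B ∪ {v}
-- would still be bad), so j(v) is well defined.  Moving every vertex v to
-- the class S_{j(v)} gives a partition P' whose classes differ from those
-- of P only inside J = J(G,P,B,2α).  Moving the class from S_j to S'_j
-- changes a neighbourhood difference by at most |S_j △ S'_j| ≤ |J|, so if
-- |J| < αn then P' is an α-adjustment: every v ∈ S'_{j(v)} is a
-- (2α + α)-clone of some b ∈ B w.r.t. S'_{j(v)}.  Hence a graph without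
-- α-adjustments has |J| ≥ αn, i.e. the same P and B witness G ∈ 𝓒.

open import Defs hiding (sym)
open import Data.Nat using (ℕ)
open import Data.Rational using (ℚ; 0ℚ; _<_)
open import Data.Product using (Σ; _×_)

import Data.Nat as ℕ
import Data.Nat.Properties as ℕP
open import Algebra.Properties.CommutativeSemigroup ℕP.+-commutativeSemigroup
  using (interchange)
open import Data.Integer as ℤ using (+_)
import Data.Integer.Properties as ℤP
open import Data.Rational using (mkℚ; 1ℚ; nonNegative; _≤_; _+_; _*_; *≤*; *<*; _≤?_)
open import Data.Rational.Properties
  using (normalize-coprime; ≤-trans; <⇒≤; ≰⇒>; +-mono-≤; *-distribʳ-+;
         *-identityˡ; nonNeg*nonNeg⇒nonNeg; nonNegative⁻¹)
open import Data.Nat.Coprimality using (1-coprimeTo) renaming (sym to coprime-sym)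
open import Data.Bool using (Bool; true; false; _∧_; _∨_; _xor_; not; if_then_else_)
open import Data.Bool.Properties using (xor-comm; xor-same; ∧-zeroʳ) renaming (_≟_ to _≟ᵇ_)
open import Data.Fin as Fin using (Fin)
import Data.Fin.Properties as FinP
open import Data.Sum using (_⊎_; inj₁; inj₂; [_,_]′)
open import Data.Product using (_,_; proj₁; proj₂)
open import Relation.Nullary using (¬_; Dec; yes; no; does; contradiction)
open import Relation.Nullary.Decidable using (_×-dec_)
open import Relation.Binary.PropositionalEquality
  using (_≡_; _≢_; refl; sym; trans; cong; cong₂; subst; subst₂; module ≡-Reasoning)

-- #ℚ a is the normal form a/1; needed to compute with #ℚ on variables.
#ℚ-mkℚ : ∀ a → #ℚ a ≡ mkℚ (+ a) 0 (coprime-sym (1-coprimeTo a))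
#ℚ-mkℚ a = normalize-coprime (coprime-sym (1-coprimeTo a))

#ℚ-mono : ∀ {a b} → a ℕ.≤ b → #ℚ a ≤ #ℚ b
#ℚ-mono {a} {b} a≤b rewrite #ℚ-mkℚ a | #ℚ-mkℚ b =
  *≤* (subst₂ ℤ._≤_ (sym (ℤP.*-identityʳ (+ a))) (sym (ℤP.*-identityʳ (+ b)))
                    (ℤ.+≤+ a≤b))

#ℚ-+ : ∀ a b → #ℚ (a ℕ.+ b) ≡ #ℚ a + #ℚ b
#ℚ-+ a b rewrite #ℚ-mkℚ a | #ℚ-mkℚ b =
  cong (Data.Rational._/ 1)
       (cong₂ ℤ._+_ (sym (ℤP.*-identityʳ (+ a))) (sym (ℤP.*-identityʳ (+ b))))

0≤#ℚ : ∀ a → 0ℚ ≤ #ℚ a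
0≤#ℚ a = #ℚ-mono {0} {a} ℕ.z≤n

0≤* : ∀ p q → 0ℚ ≤ p → 0ℚ ≤ q → 0ℚ ≤ p * q
0≤* p q 0≤p 0≤q =
  nonNegative⁻¹ (p * q) {{nonNeg*nonNeg⇒nonNeg p {{nonNegative 0≤p}} q {{nonNegative 0≤q}}}}

𝟙 : Bool → ℕ
𝟙 b = if b then 1 else 0

size-⊆∪ : ∀ {n} (X Y Z : Fin n → Bool) →
  (∀ x → X x ≡ true → Y x ≡ true ⊎ Z x ≡ true) → size X ℕ.≤ size Y ℕ.+ size Z
size-⊆∪ {ℕ.zero}  X Y Z X⊆Y∪Z = ℕ.z≤n
size-⊆∪ {ℕ.suc n} X Y Z X⊆Y∪Z = ℕP.≤-trans
  (ℕP.+-mono-≤ (indicator-⊆∪ (X Fin.zero) (Y Fin.zero) (Z Fin.zero) (X⊆Y∪Z Fin.zero))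
               (size-⊆∪ (X ∘suc) (Y ∘suc) (Z ∘suc) (λ x → X⊆Y∪Z (Fin.suc x))))
  (ℕP.≤-reflexive (interchange (𝟙 (Y Fin.zero)) (𝟙 (Z Fin.zero)) (size (Y ∘suc)) (size (Z ∘suc))))
  where
  _∘suc : (Fin (ℕ.suc n) → Bool) → Fin n → Bool
  W ∘suc = λ i → W (Fin.suc i)

  indicator-⊆∪ : ∀ x y z → (x ≡ true → y ≡ true ⊎ z ≡ true) → 𝟙 x ℕ.≤ 𝟙 y ℕ.+ 𝟙 z
  indicator-⊆∪ false y z _ = ℕ.z≤n
  indicator-⊆∪ true  y z x⇒ with x⇒ refl
  ... | inj₁ refl = ℕ.s≤s ℕ.z≤n
  ... | inj₂ refl = ℕP.m≤n+m 1 (𝟙 y)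

size-∅ : ∀ n → size {n} (λ _ → false) ≡ 0
size-∅ ℕ.zero    = refl
size-∅ (ℕ.suc n) = size-∅ n

size-⊆ : ∀ {n} (X Y : Fin n → Bool) → (∀ x → X x ≡ true → Y x ≡ true) → size X ℕ.≤ size Y
size-⊆ {n} X Y X⊆Y = subst (size X ℕ.≤_) (trans (cong (size Y ℕ.+_) (size-∅ n)) (ℕP.+-identityʳ _))
  (size-⊆∪ X Y (λ _ → false) (λ x x∈X → inj₁ (X⊆Y x x∈X)))

size-≗ : ∀ {n} (X Y : Fin n → Bool) → (∀ x → X x ≡ Y x) → size X ≡ size Y
size-≗ X Y X≗Y = ℕP.≤-antisym (size-⊆ X Y (λ x e → trans (sym (X≗Y x)) e))
                              (size-⊆ Y X (λ x e → trans (X≗Y x) e))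

least-witness : ∀ {r} (P : Fin r → Set) → (∀ j → Dec (P j)) → Σ (Fin r) P →
  Σ (Fin r) λ j → P j × (∀ j' → j' Fin.< j → ¬ P j')
least-witness {ℕ.suc r} P P? (j , pj) with P? Fin.zero | j
... | yes p0 | _        = Fin.zero , p0 , λ _ ()
... | no ¬p0 | Fin.zero = contradiction pj ¬p0
... | no ¬p0 | Fin.suc k
  with least-witness (λ i → P (Fin.suc i)) (λ i → P? (Fin.suc i)) (k , pj)
... | k' , pk' , below-k' = Fin.suc k' , pk' , below
  where
  below : ∀ j' → j' Fin.< Fin.suc k' → ¬ P j'
  below Fin.zero     _          = ¬p0
  below (Fin.suc j') (ℕ.s≤s j'<k') = below-k' j' j'<k'

module Neighbourhoods {n : ℕ} (G : Graph n) where

  nbDiff-sym : ∀ u v A → nbDiff G u v A ≡ nbDiff G v u A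
  nbDiff-sym u v A = size-≗ _ _ (λ w → cong (A w ∧_) (xor-comm (adj G u w) (adj G v w)))

  nbDiff-self : ∀ v A → nbDiff G v v A ≡ 0
  nbDiff-self v A = trans (size-≗ _ _ (λ w → trans (cong (A w ∧_) (xor-same (adj G v w)))
                                                   (∧-zeroʳ (A w))))
                          (size-∅ n)

  nbDiff-transfer : ∀ u v X Y → nbDiff G u v Y ℕ.≤ nbDiff G u v X ℕ.+ symDiff G X Y
  nbDiff-transfer u v X Y = size-⊆∪ _ _ _ (λ w → split (X w) (Y w) (adj G u w xor adj G v w))
    where
    split : ∀ x y d → y ∧ d ≡ true → x ∧ d ≡ true ⊎ x xor y ≡ true
    split false true d _ = inj₂ refl
    split true  true d e = inj₁ e

  part-local : ∀ {r} (p q : Fin n → Fin r) i x → p x ≡ q x → part G p i x ≡ part G q i x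
  part-local p q i x px≡qx = cong (λ c → part G (λ _ → c) i x) px≡qx

  Disagree : ∀ {r} → (Fin n → Fin r) → (Fin n → Fin r) → VSet n
  Disagree p q x = not (does (p x Fin.≟ q x))

  Disagree-sound : ∀ {r} (p q : Fin n → Fin r) x → x ∈ₛ Disagree p q → p x ≢ q x
  Disagree-sound p q x x∈D with p x Fin.≟ q x
  ... | no px≢qx = px≢qx

  symDiff-parts : ∀ {r} (p q : Fin n → Fin r) j →
    symDiff G (part G p j) (part G q j) ℕ.≤ size (Disagree p q)
  symDiff-parts p q j = size-⊆ _ _ moved
    where
    moved : ∀ x → (part G p j x xor part G q j x) ≡ true → x ∈ₛ Disagree p q
    moved x x∈△ with p x Fin.≟ q x
    ... | no  _     = refl
    ... | yes px≡qx = trans (sym (xor-same (part G p j x)))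
                            (trans (cong (part G p j x xor_) (part-local p q j x px≡qx)) x∈△)

module MaximalBadSet {n : ℕ} (G : Graph n) {r : ℕ} (β : ℚ) (s : Fin n → Fin r)
                     (B : VSet n) (B-maxBad : MaxBad G β s B)
                     (0≤βn : 0ℚ ≤ β * #ℚ n) where

  open Neighbourhoods G

  insert : Fin n → VSet n → VSet n
  insert v X x = X x ∨ does (x Fin.≟ v)

  insert-member : ∀ v x → x ∈ₛ insert v B → x ∈ₛ B ⊎ x ≡ v
  insert-member v x x∈ with B x | x Fin.≟ v
  ... | true  | _        = inj₁ refl
  ... | false | yes x≡v  = inj₂ x≡v

  B⊆insert : ∀ v → B ⊆ₛ insert v B
  B⊆insert v x x∈B rewrite x∈B = refl

  v∈insert : ∀ v → v ∈ₛ insert v B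
  v∈insert v with B v | v Fin.≟ v
  ... | true  | _       = refl
  ... | false | yes _   = refl
  ... | false | no v≢v  = contradiction refl v≢v

  insert-bad : ∀ v → (∀ w j → w ∈ₛ B → β * #ℚ n ≤ #ℚ (nbDiff G v w (part G s j))) →
               Bad G β s (insert v B)
  insert-bad v far u w u∈ w∈ u≢w j =
    by-cases (insert-member v u u∈) (insert-member v w w∈) u≢w
    where
    by-cases : ∀ {u w} → u ∈ₛ B ⊎ u ≡ v → w ∈ₛ B ⊎ w ≡ v → u ≢ w →
               β * #ℚ n ≤ #ℚ (nbDiff G u w (part G s j))
    by-cases {u} {w} (inj₁ u∈B)  (inj₁ w∈B)  u≢w = proj₁ B-maxBad u w u∈B w∈B u≢w j
    by-cases {w = w} (inj₂ refl) (inj₁ w∈B)  _   = far w j w∈B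
    by-cases {u}     (inj₁ u∈B)  (inj₂ refl) _   =
      subst (λ k → β * #ℚ n ≤ #ℚ k) (nbDiff-sym v u (part G s j)) (far u j u∈B)
    by-cases         (inj₂ refl) (inj₂ refl) u≢w = contradiction refl u≢w

  hasCloneIn? : ∀ v j → Dec (HasCloneIn G β s B v j)
  hasCloneIn? v j = FinP.any? (λ b → (B b ≟ᵇ true) ×-dec
                                      (#ℚ (nbDiff G v b (part G s j)) ≤? β * #ℚ n))

  -- By maximality of B, every vertex is a β-clone, w.r.t. some class S_j,
  -- of some b ∈ B: otherwise insert v B would be a larger bad set, whence
  -- v ∈ B, yet v is a clone of itself.
  maxBad-clone : ∀ v → Σ (Fin r) (HasCloneIn G β s B v)
  maxBad-clone v = from-dec (FinP.any? (hasCloneIn? v))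
    where
    from-dec : Dec (Σ (Fin r) (HasCloneIn G β s B v)) → Σ (Fin r) (HasCloneIn G β s B v)
    from-dec (yes clone) = clone
    from-dec (no ¬clone) = contradiction (s v , v , v∈B , v-self-clone) ¬clone
      where
      far : ∀ w j → w ∈ₛ B → β * #ℚ n ≤ #ℚ (nbDiff G v w (part G s j))
      far w j w∈B = far-dec (#ℚ (nbDiff G v w (part G s j)) ≤? β * #ℚ n)
        where
        far-dec : Dec (#ℚ (nbDiff G v w (part G s j)) ≤ β * #ℚ n) →
                  β * #ℚ n ≤ #ℚ (nbDiff G v w (part G s j))
        far-dec (yes close) = contradiction (j , w , w∈B , close) ¬clone
        far-dec (no ¬close) = <⇒≤ (≰⇒> ¬close)

      v∈B : v ∈ₛ B
      v∈B = proj₂ B-maxBad (insert v B) (insert-bad v far) (B⊆insert v) v (v∈insert v)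

      v-self-clone : Clone G β v v (part G s (s v))
      v-self-clone = subst (λ k → #ℚ k ≤ β * #ℚ n) (sym (nbDiff-self v (part G s (s v)))) 0≤βn

  -- Kept opaque: only its specification is used, and unfolding the search
  -- inside types involving #ℚ makes type checking very expensive.
  opaque
    jOf-spec : ∀ v → Σ (Fin r) (IsJ G β s B v)
    jOf-spec v = least-witness (HasCloneIn G β s B v) (hasCloneIn? v) (maxBad-clone v)

  jOf : Fin n → Fin r
  jOf v = proj₁ (jOf-spec v)

  jOf-isJ : ∀ v → IsJ G β s B v (jOf v)
  jOf-isJ v = proj₂ (jOf-spec v)

  -- J(G,P,B,β) = { v : v ∉ S_{j(v)} }: the vertices that P' = (S'_j) with
  -- S'_j = { v : j(v) = j } moves.
  J : VSet n
  J = Disagree s jOf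

  J-inJ : ∀ v → v ∈ₛ J → InJ G β s B v
  J-inJ v v∈J = jOf v , jOf-isJ v , Disagree-sound s jOf v v∈J

  moved-classes : ∀ j → symDiff G (part G s j) (part G jOf j) ℕ.≤ size J
  moved-classes = symDiff-parts s jOf

  clone-after-moving : ∀ α → #ℚ (size J) ≤ α * #ℚ n → ∀ v →
    Σ (Fin n) λ b → b ∈ₛ B × (#ℚ (nbDiff G v b (part G jOf (jOf v))) ≤ β * #ℚ n + α * #ℚ n)
  clone-after-moving α J-small v = move (proj₁ (jOf-isJ v))
    where
    j = jOf v
    move : HasCloneIn G β s B v j →
      Σ (Fin n) λ b → b ∈ₛ B × (#ℚ (nbDiff G v b (part G jOf j)) ≤ β * #ℚ n + α * #ℚ n)
    move (b , b∈B , clone) = b , b∈B , (begin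
      #ℚ d'               ≤⟨ #ℚ-mono {d'} {d ℕ.+ size J} d'≤d+|J| ⟩
      #ℚ (d ℕ.+ size J)   ≡⟨ #ℚ-+ d (size J) ⟩
      #ℚ d + #ℚ (size J)  ≤⟨ +-mono-≤ clone J-small ⟩
      β * #ℚ n + α * #ℚ n ∎)
      where
      open Data.Rational.Properties.≤-Reasoning
      d d' : ℕ
      d  = nbDiff G v b (part G s j)
      d' = nbDiff G v b (part G jOf j)

      d'≤d+|J| : d' ℕ.≤ d ℕ.+ size J
      d'≤d+|J| = ℕP.≤-trans (nbDiff-transfer v b (part G s j) (part G jOf j))
                            (ℕP.+-monoʳ-≤ d (moved-classes j))

radii-add : ∀ α N → (2ℚ * α) * N + α * N ≡ (3ℚ * α) * N
radii-add α N = begin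
  (2ℚ * α) * N + α * N         ≡⟨ cong (λ t → (2ℚ * α) * N + t * N) (sym (*-identityˡ α)) ⟩
  (2ℚ * α) * N + (1ℚ * α) * N  ≡⟨ sym (*-distribʳ-+ N (2ℚ * α) (1ℚ * α)) ⟩
  (2ℚ * α + 1ℚ * α) * N        ≡⟨ cong (_* N) (sym (*-distribʳ-+ α 2ℚ 1ℚ)) ⟩
  (3ℚ * α) * N                 ∎
  where open ≡-Reasoning

large-J-or-adjustment : ∀ {n} (G : Graph n) {r} (α : ℚ) → 0ℚ ≤ α →
  (s : Fin n → Fin r) (B : VSet n) → MaxBad G (2ℚ * α) s B →
  JAtLeast G (2ℚ * α) s B (α * #ℚ n) ⊎ Σ (Fin n → Fin r) (Adjustment G α s B)
large-J-or-adjustment {n} G α 0≤α s B B-maxBad = decide (α * #ℚ n ≤? #ℚ (size J))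
  where
  0≤2αn : 0ℚ ≤ (2ℚ * α) * #ℚ n
  0≤2αn = 0≤* (2ℚ * α) (#ℚ n) (0≤* 2ℚ α (0≤#ℚ 2) 0≤α) (0≤#ℚ n)
  open MaximalBadSet G (2ℚ * α) s B B-maxBad 0≤2αn

  decide : Dec (α * #ℚ n ≤ #ℚ (size J)) →
           JAtLeast G (2ℚ * α) s B (α * #ℚ n) ⊎ Σ (Fin _ → Fin _) (Adjustment G α s B)
  decide (yes J-large) = inj₁ (J , J-large , J-inJ)
  decide (no  J-small) = inj₂ (jOf , moved-small , clone-3α)
    where
    |J|≤αn : #ℚ (size J) ≤ α * #ℚ n
    |J|≤αn = <⇒≤ (≰⇒> J-small)

    moved-small : ∀ j → #ℚ (symDiff G (part G s j) (part G jOf j)) ≤ α * #ℚ n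
    moved-small j = ≤-trans (#ℚ-mono (moved-classes j)) |J|≤αn

    clone-3α : ∀ v → Σ (Fin n) λ b → b ∈ₛ B × Clone G (3ℚ * α) v b (part G jOf (jOf v))
    clone-3α v =
      let b , b∈B , close = clone-after-moving α |J|≤αn v
      in  b , b∈B , subst (#ℚ (nbDiff G v b (part G jOf (jOf v))) ≤_) (radii-add α (#ℚ n)) close

lemma14 : (r : ℕ) (𝓟 : Hereditary) → χc≡ 𝓟 r →
    (α : ℚ) → 0ℚ < α →
    Σ ℚ (λ ε₀ → 0ℚ < ε₀ ×
      ((ε δ γ : ℚ) → 0ℚ < ε → ε < ε₀ → 0ℚ < δ → δ < ε₀ → 0ℚ < γ → γ < ε₀ →
        (n : ℕ) (G : Graph n) → InD 𝓟 r ε δ γ α n G → InC 𝓟 r ε δ γ α n G))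
lemma14 r 𝓟 _ α 0<α = 1ℚ , 0<1 , λ ε δ γ _ _ _ _ _ _ → 𝓓⊆𝓒 ε δ γ
  where
  0<1 : 0ℚ < 1ℚ
  0<1 = *<* (ℤ.+<+ (ℕ.s≤s ℕ.z≤n))

  𝓓⊆𝓒 : ∀ ε δ γ n (G : Graph n) → InD 𝓟 r ε δ γ α n G → InC 𝓟 r ε δ γ α n G
  𝓓⊆𝓒 ε δ γ n G (G∈𝓟 , s , bbs , B , B-maxBad , no-adjustment) =
    [ (λ J-large → G∈𝓟 , s , bbs , B , B-maxBad , J-large)
    , (λ adjustment → contradiction adjustment no-adjustment)
    ]′ (large-J-or-adjustment G α (<⇒≤ 0<α) s B B-maxBad)
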